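{- Let $X=(\Omega,\mathcal{B})$ be a balanced configuration of type $(n_k)$. If $C\le\operatorname{Aut}X$ is a cyclic subgroup which acts regularly on $\Omega$, then $C$ acts regularly on $\mathcal{B}$ as well.
   Context: An incidence geometry $(\Omega,\mathcal{B})$ consists of a finite set $\Omega$ of points and a collection $\mathcal{B}\subseteq 2^\Omega$ of lines with $|B\cap B'|\le 1$ for distinct $B,B'\in\mathcal{B}$. A balanced configuration of type $(n_k)$ is one with $|\Omega|=|\mathcal{B}|=n$, every point on exactly $k$ lines and every line containing exactly $k$ points, $k\ge 3$. $\operatorname{Aut}X$ is the group of permutations $g$ of $\Omega$ with $\mathcal{B}^g=\mathcal{B}$; it acts on $\mathcal{B}$ naturally. -}

module Defs where

open import Data.Nat using (ℕ; zero; suc; _≤_)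
open import Data.Fin using (Fin)
open import Data.Fin.Subset using (Subset; _∈_; _∩_; ∣_∣)
open import Data.Fin.Permutation using (Permutation′; _⟨$⟩ʳ_; _⟨$⟩ˡ_; _∘ₚ_; id; _≈_)
open import Data.Vec using (tabulate; lookup)
open import Data.Product using (∃; _×_)
open import Relation.Binary.PropositionalEquality using (_≡_; _≢_)
open import Function.Definitions using (Injective)

-- An incidence geometry on the point set Ω = Fin n whose line set ℬ has
-- exactly n elements, given by an injective labelling  L : Fin n → Subset n
-- (injectivity = the n labelled lines are pairwise distinct, so |ℬ| = n).
record BalancedConfig (n k : ℕ) : Set where
  field
    line       : Fin n → Subset n
    line-inj   : Injective _≡_ _≡_ line
    linear     : ∀ i j → i ≢ j → ∣ line i ∩ line j ∣ ≤ 1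
    line-size  : ∀ i → ∣ line i ∣ ≡ k
    point-deg  : ∀ x → ∣ tabulate (λ i → lookup (line i) x) ∣ ≡ k
    k≥3        : 3 ≤ k

open BalancedConfig public

image : ∀ {n} → Permutation′ n → Subset n → Subset n
image g S = tabulate (λ y → lookup S (g ⟨$⟩ˡ y))

IsAut : ∀ {n k} → BalancedConfig n k → Permutation′ n → Set
IsAut X g =
  (∀ i → ∃ λ j → image g (line X i) ≡ line X j) ×
  (∀ j → ∃ λ i → image g (line X i) ≡ line X j)

-- powers g^m (x^(g^(m+1)) = (x^(g^m))^g); the cyclic group ⟨g⟩ = { g^m : m ∈ ℕ }
-- (g has finite order, so nonnegative powers exhaust ⟨g⟩).
pow : ∀ {n} → Permutation′ n → ℕ → Permutation′ n
pow g zero    = id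
pow g (suc m) = pow g m ∘ₚ g

RegularOnPoints : ∀ {n} → Permutation′ n → Set
RegularOnPoints {n} g =
  (∀ (x y : Fin n) → ∃ λ m → pow g m ⟨$⟩ʳ x ≡ y) ×
  (∀ m (x : Fin n) → pow g m ⟨$⟩ʳ x ≡ x → pow g m ≈ id)

RegularOnLines : ∀ {n k} → BalancedConfig n k → Permutation′ n → Set
RegularOnLines {n} X g =
  (∀ (i j : Fin n) → ∃ λ m → image (pow g m) (line X i) ≡ line X j) ×
  (∀ m (i : Fin n) → image (pow g m) (line X i) ≡ line X i → pow g m ≈ id)

-- Since C is abelian, all lines of one C-orbit have the same stabiliser in C.
-- A line with trivial stabiliser has n distinct translates, so its orbit is
-- all of ℬ; hence one trivial stabiliser makes every stabiliser trivial, and C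
-- is then regular on ℬ.  Suppose instead that c ≠ 1 stabilises a line B ∋ x.
-- As B is the only line through the distinct points y and yᶜ of B, linearity
-- forces B^h = B whenever B^h meets B: the translates of B partition Ω, so the
-- stabiliser C_B has index n / k in C.  Two lines through x with nontrivial
-- stabilisers therefore have stabilisers of the same index in the cyclic group
-- C, hence equal stabilisers, hence both equal x^{C_B}.  As x lies on k ≥ 2
-- lines, some stabiliser must be trivial after all.
module Submission where

open import Defs
open import Data.Bool.Properties using () renaming (_≟_ to _≟ᵇ_)
open import Data.Fin using (Fin; zero; punchOut)
open import Data.Fin.Properties using (all?; any?; punchOut-injective; injective⇒≤)
  renaming (_≟_ to _≟ᶠ_)
open import Data.Fin.Permutation
  using (Permutation′; _⟨$⟩ʳ_; _⟨$⟩ˡ_; _∘ₚ_; id; _≈_; inverseˡ; inverseʳ)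
open import Data.Fin.Subset
  using (Subset; _∈_; _⊆_; _∩_; _∪_; ⊤; ⁅_⁆; ∣_∣; Nonempty; Empty; inside; outside)
  renaming (⊥ to ∅)
open import Data.Fin.Subset.Properties
  using ( _∈?_; nonempty?; Empty-unique; drop-∷-Empty; ∉⊥; ⊆⊤; ⊆-antisym
        ; ∣⊥∣≡0; ∣⊤∣≡n; ∣⁅x⁆∣≡1; x∈⁅x⁆; x∈⁅y⁆⇒x≡y; p⊆q⇒∣p∣≤∣q∣
        ; x∈p∩q⁺; x∈p∩q⁻; x∈p∪q⁺; x∈p∪q⁻; x∈p∧x≢y⇒x∈p-y; x∈p⇒∣p-x∣<∣p∣ )
open import Data.Nat using (ℕ; zero; suc; _+_; _*_; _≤_; _<_; z≤n; s≤s; NonZero; >-nonZero)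
open import Data.Nat.Properties
open import Data.Nat.DivMod using (_%_; _/_; m≡m%n+[m/n]*n; m%n<n)
open import Data.Nat.Divisibility using (_∣_; divides; m%n≡0⇒n∣m)
open import Data.Nat.Induction using (<-rec)
open import Data.Product using (∃; _×_; _,_; proj₁; proj₂)
open import Data.Sum using (inj₁; inj₂)
open import Data.Vec using ([]; _∷_; lookup; tabulate; here)
open import Data.Vec.Properties
  using (lookup∘tabulate; tabulate∘lookup; tabulate-cong; lookup⇒[]=; []=⇒lookup; ≡-dec)
open import Function using (_∘_)
open import Function.Definitions using (Injective)
open import Relation.Nullary using (¬_; Dec; yes; no; contradiction; ¬?; _×-dec_)
open import Relation.Nullary.Decidable using (map′)
open import Relation.Unary using (Pred; Decidable)
open import Relation.Binary.PropositionalEquality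

injective⇒surjective : ∀ {n} {f : Fin n → Fin n} → Injective _≡_ _≡_ f →
                       ∀ y → ∃ λ x → f x ≡ y
injective⇒surjective {suc n} {f} f-inj y with any? (λ x → f x ≟ᶠ y)
... | yes hit = hit
... | no miss = contradiction (injective⇒≤ punched-inj) (<-irrefl refl)
  where
  y≢f : ∀ x → y ≢ f x
  y≢f x y≡fx = miss (x , sym y≡fx)

  punched-inj : Injective _≡_ _≡_ (λ x → punchOut (y≢f x))
  punched-inj {x} {x′} eq = f-inj (punchOut-injective (y≢f x) (y≢f x′) eq)

module _ {n : ℕ} where

  x∈p⇒0<∣p∣ : ∀ {p : Subset n} {x} → x ∈ p → 0 < ∣ p ∣
  x∈p⇒0<∣p∣ {p} {x} x∈p = subst (_≤ ∣ p ∣) (∣⁅x⁆∣≡1 x)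
    (p⊆q⇒∣p∣≤∣q∣ λ y∈⁅x⁆ → subst (_∈ p) (sym (x∈⁅y⁆⇒x≡y x y∈⁅x⁆)) x∈p)

  0<∣p∣⇒nonempty : ∀ (p : Subset n) → 0 < ∣ p ∣ → Nonempty p
  0<∣p∣⇒nonempty p 0<∣p∣ with nonempty? p
  ... | yes nonempty = nonempty
  ... | no empty     = contradiction (trans (cong ∣_∣ (Empty-unique empty)) (∣⊥∣≡0 n)) (>⇒≢ 0<∣p∣)

  x∈p∧y∈p∧x≢y⇒1<∣p∣ : ∀ {p : Subset n} {x y} → x ∈ p → y ∈ p → x ≢ y → 1 < ∣ p ∣
  x∈p∧y∈p∧x≢y⇒1<∣p∣ x∈p y∈p x≢y =
    ≤-trans (s≤s (x∈p⇒0<∣p∣ (x∈p∧x≢y⇒x∈p-y y∈p (x≢y ∘ sym)))) (x∈p⇒∣p-x∣<∣p∣ x∈p)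

  1<∣p∣⇒∃≢ : ∀ (p : Subset n) → 1 < ∣ p ∣ → ∀ x → ∃ λ y → y ∈ p × y ≢ x
  1<∣p∣⇒∃≢ p 1<∣p∣ x with any? (λ y → (y ∈? p) ×-dec ¬? (y ≟ᶠ x))
  ... | yes found = found
  ... | no none   = contradiction (subst (∣ p ∣ ≤_) (∣⁅x⁆∣≡1 x) (p⊆q⇒∣p∣≤∣q∣ p⊆⁅x⁆)) (<⇒≱ 1<∣p∣)
    where
    p⊆⁅x⁆ : p ⊆ ⁅ x ⁆
    p⊆⁅x⁆ {y} y∈p with y ≟ᶠ x
    ... | yes refl = x∈⁅x⁆ x
    ... | no y≢x   = contradiction (y , y∈p , y≢x) none

∣p∪q∣≡∣p∣+∣q∣ : ∀ {n} (p q : Subset n) → Empty (p ∩ q) → ∣ p ∪ q ∣ ≡ ∣ p ∣ + ∣ q ∣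
∣p∪q∣≡∣p∣+∣q∣ []            []            _        = refl
∣p∪q∣≡∣p∣+∣q∣ (inside  ∷ p) (inside  ∷ q) disjoint = contradiction (zero , here) disjoint
∣p∪q∣≡∣p∣+∣q∣ (inside  ∷ p) (outside ∷ q) disjoint =
  cong suc (∣p∪q∣≡∣p∣+∣q∣ p q (drop-∷-Empty disjoint))
∣p∪q∣≡∣p∣+∣q∣ (outside ∷ p) (inside  ∷ q) disjoint =
  trans (cong suc (∣p∪q∣≡∣p∣+∣q∣ p q (drop-∷-Empty disjoint))) (sym (+-suc ∣ p ∣ ∣ q ∣))
∣p∪q∣≡∣p∣+∣q∣ (outside ∷ p) (outside ∷ q) disjoint = ∣p∪q∣≡∣p∣+∣q∣ p q (drop-∷-Empty disjoint)

module _ {n a k : ℕ} (T : ℕ → Subset n)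
         (size     : ∀ c → c < a → ∣ T c ∣ ≡ k)
         (disjoint : ∀ {c c′} → c < c′ → c′ < a → Empty (T c ∩ T c′))
         (cover    : ∀ y → ∃ λ c → c < a × y ∈ T c) where

  private
    ⋃T : ℕ → Subset n
    ⋃T zero    = ∅
    ⋃T (suc r) = ⋃T r ∪ T r

    ∈⋃T⁺ : ∀ {r c y} → c < r → y ∈ T c → y ∈ ⋃T r
    ∈⋃T⁺ {suc r} c<1+r y∈Tc with m<1+n⇒m<n∨m≡n c<1+r
    ... | inj₁ c<r  = x∈p∪q⁺ (inj₁ (∈⋃T⁺ c<r y∈Tc))
    ... | inj₂ refl = x∈p∪q⁺ (inj₂ y∈Tc)

    ∈⋃T⁻ : ∀ {r y} → y ∈ ⋃T r → ∃ λ c → c < r × y ∈ T c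
    ∈⋃T⁻ {zero}  y∈∅ = contradiction y∈∅ ∉⊥
    ∈⋃T⁻ {suc r} y∈⋃ with x∈p∪q⁻ (⋃T r) (T r) y∈⋃
    ... | inj₁ y∈⋃T = let c , c<r , y∈Tc = ∈⋃T⁻ y∈⋃T in c , m<n⇒m<1+n c<r , y∈Tc
    ... | inj₂ y∈Tr = r , ≤-refl , y∈Tr

    ∣⋃T∣ : ∀ {r} → r ≤ a → ∣ ⋃T r ∣ ≡ r * k
    ∣⋃T∣ {zero}  _   = ∣⊥∣≡0 n
    ∣⋃T∣ {suc r} r<a = begin
      ∣ ⋃T r ∪ T r ∣      ≡⟨ ∣p∪q∣≡∣p∣+∣q∣ (⋃T r) (T r) ⋃T∩Tr-empty ⟩
      ∣ ⋃T r ∣ + ∣ T r ∣  ≡⟨ cong₂ _+_ (∣⋃T∣ (<⇒≤ r<a)) (size r r<a) ⟩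
      r * k + k           ≡⟨ +-comm (r * k) k ⟩
      suc r * k           ∎
      where
      open ≡-Reasoning
      ⋃T∩Tr-empty : Empty (⋃T r ∩ T r)
      ⋃T∩Tr-empty (y , y∈∩) with x∈p∩q⁻ (⋃T r) (T r) y∈∩
      ... | y∈⋃T , y∈Tr with ∈⋃T⁻ y∈⋃T
      ...   | c , c<r , y∈Tc = disjoint c<r r<a (y , x∈p∩q⁺ (y∈Tc , y∈Tr))

    ⋃T≡⊤ : ⋃T a ≡ ⊤
    ⋃T≡⊤ = ⊆-antisym ⊆⊤ λ {y} _ → let c , c<a , y∈Tc = cover y in ∈⋃T⁺ c<a y∈Tc

  equipartition-size : a * k ≡ n
  equipartition-size = trans (sym (∣⋃T∣ ≤-refl)) (trans (cong ∣_∣ ⋃T≡⊤) (∣⊤∣≡n n))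

Least : ∀ {p} → Pred ℕ p → ℕ → Set p
Least P a = P a × (∀ {r} → r < a → ¬ P r)

least-solution : ∀ {p} {P : Pred ℕ p} → Decidable P → ∀ {m} → P m → ∃ (Least P)
least-solution {P = P} P? {m} = <-rec (λ m → P m → ∃ (Least P)) step m
  where
  step : ∀ m → (∀ {r} → r < m → P r → ∃ (Least P)) → P m → ∃ (Least P)
  step m smaller Pm with anyUpTo? P? m
  ... | yes (r , r<m , Pr) = smaller r<m Pr
  ... | no none            = m , Pm , λ r<m Pr → none (_ , r<m , Pr)

module _ {n : ℕ} where

  ∈-image⁺ : ∀ (π : Permutation′ n) {S x} → x ∈ S → π ⟨$⟩ʳ x ∈ image π S
  ∈-image⁺ π {S} {x} x∈S = lookup⇒[]= (π ⟨$⟩ʳ x) (image π S)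
    (trans (lookup∘tabulate (λ y → lookup S (π ⟨$⟩ˡ y)) (π ⟨$⟩ʳ x))
      (trans (cong (lookup S) (inverseˡ π)) ([]=⇒lookup x∈S)))

  ∈-image⁻ : ∀ (π : Permutation′ n) {S y} → y ∈ image π S → π ⟨$⟩ˡ y ∈ S
  ∈-image⁻ π {S} {y} y∈πS = lookup⇒[]= (π ⟨$⟩ˡ y) S
    (trans (sym (lookup∘tabulate (λ y → lookup S (π ⟨$⟩ˡ y)) y)) ([]=⇒lookup y∈πS))

  image-id : ∀ (S : Subset n) → image id S ≡ S
  image-id S = tabulate∘lookup S

  image-∘ₚ : ∀ (π ρ : Permutation′ n) S → image (π ∘ₚ ρ) S ≡ image ρ (image π S)
  image-∘ₚ π ρ S = tabulate-cong λ y → sym (lookup∘tabulate (λ z → lookup S (π ⟨$⟩ˡ z)) (ρ ⟨$⟩ˡ y))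

  image-cong : ∀ {π ρ : Permutation′ n} → π ≈ ρ → ∀ S → image π S ≡ image ρ S
  image-cong {π} {ρ} π≈ρ S = tabulate-cong λ y → cong (lookup S) (begin
    π ⟨$⟩ˡ y                        ≡⟨ cong (π ⟨$⟩ˡ_) (inverseʳ ρ) ⟨
    π ⟨$⟩ˡ (ρ ⟨$⟩ʳ (ρ ⟨$⟩ˡ y))      ≡⟨ cong (π ⟨$⟩ˡ_) (π≈ρ _) ⟨
    π ⟨$⟩ˡ (π ⟨$⟩ʳ (ρ ⟨$⟩ˡ y))      ≡⟨ inverseˡ π ⟩
    ρ ⟨$⟩ˡ y                        ∎)
    where open ≡-Reasoning

  image-injective : ∀ (π : Permutation′ n) {S T} → image π S ≡ image π T → S ≡ T
  image-injective π {S} {T} eq = ⊆-antisym (transfer {S} {T} eq) (transfer {T} {S} (sym eq))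
    where
    transfer : ∀ {S T} → image π S ≡ image π T → S ⊆ T
    transfer {S} {T} eq {x} x∈S =
      subst (_∈ T) (inverseˡ π) (∈-image⁻ π (subst (π ⟨$⟩ʳ x ∈_) eq (∈-image⁺ π x∈S)))

  module _ (g : Permutation′ n) where

    pow-+ : ∀ s t → pow g (s + t) ≈ pow g t ∘ₚ pow g s
    pow-+ zero    t x = refl
    pow-+ (suc s) t x = cong (g ⟨$⟩ʳ_) (pow-+ s t x)

    pow-comm : ∀ s t x → pow g s ⟨$⟩ʳ (pow g t ⟨$⟩ʳ x) ≡ pow g t ⟨$⟩ʳ (pow g s ⟨$⟩ʳ x)
    pow-comm s t x =
      trans (sym (pow-+ s t x)) (trans (cong (λ e → pow g e ⟨$⟩ʳ x) (+-comm s t)) (pow-+ t s x))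

    image-pow-+ : ∀ s t S → image (pow g (s + t)) S ≡ image (pow g s) (image (pow g t) S)
    image-pow-+ s t S = trans (image-cong {pow g (s + t)} {pow g t ∘ₚ pow g s} (pow-+ s t) S)
                              (image-∘ₚ (pow g t) (pow g s) S)

    image-pow-comm : ∀ s t S →
      image (pow g s) (image (pow g t) S) ≡ image (pow g t) (image (pow g s) S)
    image-pow-comm s t S = trans (sym (image-pow-+ s t S))
      (trans (cong (λ e → image (pow g e) S) (+-comm s t)) (image-pow-+ t s S))

module Regularity {n k} (X : BalancedConfig n k) (g : Permutation′ n)
                  (aut : IsAut X g) (reg : RegularOnPoints g) where

  L : Fin n → Subset n
  L = line X

  g^_ : ℕ → Permutation′ n
  g^ m = pow g m

  0<k : 0 < k
  0<k = ≤-trans (s≤s z≤n) (k≥3 X)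

  instance
    k≢0 : NonZero k
    k≢0 = >-nonZero 0<k

  point-on : ∀ i → Nonempty (L i)
  point-on i = 0<∣p∣⇒nonempty (L i) (subst (0 <_) (sym (line-size X i)) 0<k)

  another-line-through : ∀ x i → ∃ λ j → x ∈ L j × j ≢ i
  another-line-through x i with 1<∣p∣⇒∃≢ lines-through-x 1<∣lines-through-x∣ i
    where
    lines-through-x : Subset n
    lines-through-x = tabulate (λ j → lookup (L j) x)

    1<∣lines-through-x∣ : 1 < ∣ lines-through-x ∣
    1<∣lines-through-x∣ = subst (1 <_) (sym (point-deg X x)) (≤-trans (s≤s (s≤s z≤n)) (k≥3 X))
  ... | j , j∈ , j≢i =
    j , lookup⇒[]= x (L j) (trans (sym (lookup∘tabulate (λ j → lookup (L j) x) j)) ([]=⇒lookup j∈)) , j≢i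

  image-line : ∀ m i → ∃ λ j → image (g^ m) (L i) ≡ L j
  image-line zero    i = i , image-id (L i)
  image-line (suc m) i with image-line m i
  ... | j , gᵐLi≡Lj with proj₁ aut j
  ...   | j′ , gLj≡Lj′ = j′ , trans (image-∘ₚ (g^ m) g (L i)) (trans (cong (image g) gᵐLi≡Lj) gLj≡Lj′)

  moves-every-point : ∀ m → ¬ (g^ m ≈ id) → ∀ x → g^ m ⟨$⟩ʳ x ≢ x
  moves-every-point m ¬id x fixed = ¬id (proj₂ reg m x fixed)

  -- A record rather than a bare equation, so that m and B can be inferred from a proof.
  record Stabilises (m : ℕ) (B : Subset n) : Set where
    constructor stabilises
    field image-fixed : image (g^ m) B ≡ B

  open Stabilises

  stabilises? : ∀ m B → Dec (Stabilises m B)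
  stabilises? m B = map′ stabilises image-fixed (≡-dec _≟ᵇ_ (image (g^ m) B) B)

  stabiliser-preserves : ∀ {m B x} → Stabilises m B → x ∈ B → g^ m ⟨$⟩ʳ x ∈ B
  stabiliser-preserves {m} {x = x} (stabilises eq) x∈B =
    subst (g^ m ⟨$⟩ʳ x ∈_) eq (∈-image⁺ (g^ m) x∈B)

  stabilises-+ : ∀ {s t B} → Stabilises s B → Stabilises t B → Stabilises (s + t) B
  stabilises-+ {s} {t} {B} (stabilises sB) (stabilises tB) =
    stabilises (trans (image-pow-+ g s t B) (trans (cong (image (g^ s)) tB) sB))

  stabilises-cancelʳ : ∀ {s t B} → Stabilises t B → Stabilises (s + t) B → Stabilises s B
  stabilises-cancelʳ {s} {t} {B} (stabilises tB) (stabilises s+tB) =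
    stabilises (trans (cong (image (g^ s)) (sym tB)) (trans (sym (image-pow-+ g s t B)) s+tB))

  stabilises-* : ∀ {a B} → Stabilises a B → ∀ q → Stabilises (q * a) B
  stabilises-* {B = B} _  zero    = stabilises (image-id B)
  stabilises-*         aB (suc q) = stabilises-+ aB (stabilises-* aB q)

  stabilises-translate : ∀ e {m B} → Stabilises m (image (g^ e) B) → Stabilises m B
  stabilises-translate e {m} {B} (stabilises eq) =
    stabilises (image-injective (g^ e) (trans (image-pow-comm g e m B) eq))

  TrivialStabiliser : Subset n → Set
  TrivialStabiliser B = ∀ m → Stabilises m B → g^ m ≈ id

  NontrivialStabiliser : Subset n → Set
  NontrivialStabiliser B = ∃ λ m → Stabilises m B × ¬ (g^ m ≈ id)

  ¬nontrivial⇒trivial : ∀ {B} → ¬ NontrivialStabiliser B → TrivialStabiliser B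
  ¬nontrivial⇒trivial ¬nontrivial m st with all? (λ x → g^ m ⟨$⟩ʳ x ≟ᶠ x)
  ... | yes g^m≈id = g^m≈id
  ... | no  g^m≉id = contradiction (m , st , g^m≉id) ¬nontrivial

  -- If c ≠ 1 stabilises L i, then L i is the line through y and yᶜ for each of its points y.
  stabilises-of-∈ : ∀ {i} → NontrivialStabiliser (L i) →
                    ∀ d {z} → z ∈ L i → g^ d ⟨$⟩ʳ z ∈ L i → Stabilises d (L i)
  stabilises-of-∈ {i} (m , st , ¬id) d {z} z∈Li y∈Li with image-line d i
  ... | j , gᵈLi≡Lj with i ≟ᶠ j
  ...   | yes refl = stabilises gᵈLi≡Lj
  ...   | no  i≢j  = contradiction (linear X i j i≢j) (<⇒≱ two-common-points)
    where
    y = g^ d ⟨$⟩ʳ z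
    yᶜ = g^ m ⟨$⟩ʳ y

    y∈Lj : y ∈ L j
    y∈Lj = subst (y ∈_) gᵈLi≡Lj (∈-image⁺ (g^ d) z∈Li)

    yᶜ∈Lj : yᶜ ∈ L j
    yᶜ∈Lj = subst (yᶜ ∈_) gᵈLi≡Lj (subst (_∈ image (g^ d) (L i)) (pow-comm g d m z)
      (∈-image⁺ (g^ d) (stabiliser-preserves st z∈Li)))

    two-common-points : 1 < ∣ L i ∩ L j ∣
    two-common-points = x∈p∧y∈p∧x≢y⇒1<∣p∣
      (x∈p∩q⁺ (y∈Li , y∈Lj)) (x∈p∩q⁺ (stabiliser-preserves st y∈Li , yᶜ∈Lj))
      (λ y≡yᶜ → moves-every-point m ¬id y (sym y≡yᶜ))

  translates-meet⇒stabilises : ∀ {i} → NontrivialStabiliser (L i) → ∀ c t {y} →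
    y ∈ image (g^ c) (L i) → y ∈ image (g^ (c + t)) (L i) → Stabilises t (L i)
  translates-meet⇒stabilises {i} nontrivial c t {y} y∈Tc y∈Tc+t =
    stabilises-of-∈ nontrivial t (∈-image⁻ (g^ (c + t)) {L i} y∈Tc+t)
      (subst (_∈ L i) (sym gᵗv≡u) (∈-image⁻ (g^ c) {L i} y∈Tc))
    where
    v = g^ (c + t) ⟨$⟩ˡ y

    gᵗv≡u : g^ t ⟨$⟩ʳ v ≡ g^ c ⟨$⟩ˡ y
    gᵗv≡u = trans (sym (inverseˡ (g^ c)))
      (cong (g^ c ⟨$⟩ˡ_) (trans (sym (pow-+ g c t v)) (inverseʳ (g^ (c + t)))))

  module Period {i} (nontrivial : NontrivialStabiliser (L i)) where

    positive-stabiliser : ∃ λ r → Stabilises (suc r) (L i)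
    positive-stabiliser = positive nontrivial
      where
      positive : NontrivialStabiliser (L i) → ∃ λ r → Stabilises (suc r) (L i)
      positive (zero  , _  , ¬id) = contradiction (λ _ → refl) ¬id
      positive (suc r , st , _)   = r , st

    least : ∃ (Least (λ r → Stabilises (suc r) (L i)))
    least = least-solution (λ r → stabilises? (suc r) (L i)) (proj₂ positive-stabiliser)

    period : ℕ
    period = suc (proj₁ least)

    below-period : ∀ {r} → r < period → Stabilises r (L i) → r ≡ 0
    below-period {zero}  _   _  = refl
    below-period {suc r} r<a st = contradiction st (proj₂ (proj₂ least) (≤-pred r<a))

    ∣⇒stabilises : ∀ {d} → period ∣ d → Stabilises d (L i)
    ∣⇒stabilises (divides q refl) = stabilises-* (proj₁ (proj₂ least)) q

    stabilises⇒∣ : ∀ {d} → Stabilises d (L i) → period ∣ d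
    stabilises⇒∣ {d} st = m%n≡0⇒n∣m d period (below-period (m%n<n d period) remainder-stabilises)
      where
      remainder-stabilises : Stabilises (d % period) (L i)
      remainder-stabilises = stabilises-cancelʳ (∣⇒stabilises (divides (d / period) refl))
        (subst (λ e → Stabilises e (L i)) (m≡m%n+[m/n]*n d period) st)

    translates-disjoint : ∀ {c c′} → c < c′ → c′ < period →
                          Empty (image (g^ c) (L i) ∩ image (g^ c′) (L i))
    translates-disjoint {c} c<c′ c′<a (y , y∈∩) with m≤n⇒∃[o]m+o≡n (<⇒≤ c<c′)
    ... | t , refl with x∈p∩q⁻ (image (g^ c) (L i)) (image (g^ (c + t)) (L i)) y∈∩
    ...   | y∈Tc , y∈Tc+t
              with below-period (≤-<-trans (m≤n+m t c) c′<a)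
                                (translates-meet⇒stabilises nontrivial c t y∈Tc y∈Tc+t)
    ...     | refl = <-irrefl (sym (+-identityʳ c)) c<c′

    translates-cover : ∀ {x} → x ∈ L i → ∀ y → ∃ λ c → c < period × y ∈ image (g^ c) (L i)
    translates-cover {x} x∈Li y with proj₁ reg x y
    ... | d , refl = d % period , m%n<n d period , subst (_∈ image (g^ (d % period)) (L i)) split
      (∈-image⁺ (g^ (d % period)) (stabiliser-preserves (∣⇒stabilises (divides (d / period) refl)) x∈Li))
      where
      split : g^ (d % period) ⟨$⟩ʳ (g^ (d / period * period) ⟨$⟩ʳ x) ≡ g^ d ⟨$⟩ʳ x
      split = trans (sym (pow-+ g (d % period) (d / period * period) x))
        (cong (λ e → g^ e ⟨$⟩ʳ x) (sym (m≡m%n+[m/n]*n d period)))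

    period*k≡n : ∀ {x} → x ∈ L i → period * k ≡ n
    period*k≡n x∈Li = equipartition-size {a = period} {k = k} (λ c → image (g^ c) (L i))
      (λ c _ → let j , gᶜLi≡Lj = image-line c i in trans (cong ∣_∣ gᶜLi≡Lj) (line-size X j))
      translates-disjoint (translates-cover x∈Li)

  open Period using (period; period*k≡n; ∣⇒stabilises; stabilises⇒∣)

  same-period⇒⊆ : ∀ {i j x} (nt-i : NontrivialStabiliser (L i)) (nt-j : NontrivialStabiliser (L j)) →
    period nt-i ≡ period nt-j → x ∈ L i → x ∈ L j → L i ⊆ L j
  same-period⇒⊆ {x = x} nt-i nt-j same x∈Li x∈Lj {y} y∈Li with proj₁ reg x y
  ... | d , refl = stabiliser-preserves
    (∣⇒stabilises nt-j (subst (_∣ d) same (stabilises⇒∣ nt-i (stabilises-of-∈ nt-i d x∈Li y∈Li)))) x∈Lj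

  nontrivial-lines-through-point-coincide :
    ∀ {i j x} → NontrivialStabiliser (L i) → NontrivialStabiliser (L j) → x ∈ L i → x ∈ L j → i ≡ j
  nontrivial-lines-through-point-coincide nt-i nt-j x∈Li x∈Lj = line-inj X
    (⊆-antisym (same-period⇒⊆ nt-i nt-j same x∈Li x∈Lj) (same-period⇒⊆ nt-j nt-i (sym same) x∈Lj x∈Li))
    where
    same : period nt-i ≡ period nt-j
    same = *-cancelʳ-≡ _ _ k (trans (period*k≡n nt-i x∈Li) (sym (period*k≡n nt-j x∈Lj)))

  trivial-stabiliser-shift : ∀ {B} → TrivialStabiliser B →
    ∀ s t → image (g^ (s + t)) B ≡ image (g^ s) B → g^ (s + t) ≈ g^ s
  trivial-stabiliser-shift {B} trivial s t eq x = trans (pow-+ g s t x)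
    (cong (g^ s ⟨$⟩ʳ_) (trivial t tB x))
    where
    tB : Stabilises t B
    tB = stabilises (image-injective (g^ s) (trans (sym (image-pow-+ g s t B)) eq))

  equal-translates⇒≈ : ∀ {B} → TrivialStabiliser B →
    ∀ e e′ → image (g^ e) B ≡ image (g^ e′) B → g^ e ≈ g^ e′
  equal-translates⇒≈ trivial e e′ eq with ≤-total e e′
  ... | inj₁ e≤e′ with m≤n⇒∃[o]m+o≡n e≤e′
  ...   | t , refl = λ x → sym (trivial-stabiliser-shift trivial e t (sym eq) x)
  equal-translates⇒≈ trivial e e′ eq | inj₂ e′≤e with m≤n⇒∃[o]m+o≡n e′≤e
  ...   | t , refl = trivial-stabiliser-shift trivial e′ t eq

  trivial-stabiliser⇒orbit : ∀ {i} → TrivialStabiliser (L i) → ∀ j → ∃ λ e → image (g^ e) (L i) ≡ L j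
  trivial-stabiliser⇒orbit {i} trivial j =
    let y , fy≡j = injective⇒surjective f-injective j
    in  e y , trans (proj₂ (image-line (e y) i)) (cong L fy≡j)
    where
    x₀ = proj₁ (point-on i)

    -- Regularity on Ω indexes C by the points: y ↦ the element taking x₀ to y.
    e : Fin n → ℕ
    e y = proj₁ (proj₁ reg x₀ y)

    f : Fin n → Fin n
    f y = proj₁ (image-line (e y) i)

    f-injective : Injective _≡_ _≡_ f
    f-injective {y} {y′} fy≡fy′ = begin
      y                 ≡⟨ proj₂ (proj₁ reg x₀ y) ⟨
      g^ e y ⟨$⟩ʳ x₀    ≡⟨ equal-translates⇒≈ trivial (e y) (e y′) same-line x₀ ⟩
      g^ e y′ ⟨$⟩ʳ x₀   ≡⟨ proj₂ (proj₁ reg x₀ y′) ⟩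
      y′                ∎
      where
      open ≡-Reasoning
      same-line : image (g^ e y) (L i) ≡ image (g^ e y′) (L i)
      same-line = trans (proj₂ (image-line (e y) i))
        (trans (cong L fy≡fy′) (sym (proj₂ (image-line (e y′) i))))

  trivial-stabiliser-spreads : ∀ {i j} → TrivialStabiliser (L i) → TrivialStabiliser (L j)
  trivial-stabiliser-spreads {j = j} trivial m st with trivial-stabiliser⇒orbit trivial j
  ... | e , gᵉLi≡Lj = trivial m (stabilises-translate e (subst (Stabilises m) (sym gᵉLi≡Lj) st))

  -- The goal being ⊥, we may split on whether L j has a nontrivial stabiliser.
  stabilisers-trivial : ∀ i → TrivialStabiliser (L i)
  stabilisers-trivial i = ¬nontrivial⇒trivial λ where
    nt-i@(m , st , ¬id) →
      let x , x∈Li       = point-on i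
          j , x∈Lj , j≢i = another-line-through x i
          trivial-j      = ¬nontrivial⇒trivial λ nt-j →
                             j≢i (nontrivial-lines-through-point-coincide nt-j nt-i x∈Lj x∈Li)
      in ¬id (trivial-stabiliser-spreads trivial-j m st)

lemma2p1 : ∀ {n k} (X : BalancedConfig n k) (g : Permutation′ n) →
    IsAut X g → RegularOnPoints g → RegularOnLines X g
lemma2p1 X g aut reg =
    (λ i → trivial-stabiliser⇒orbit (stabilisers-trivial i))
  , (λ m i gᵐLi≡Li → stabilisers-trivial i m (stabilises gᵐLi≡Li))
  where open Regularity X g aut reg
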